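{- Let $G$ be a graph and $D\subseteq V(G)$ a dominating set of $G$. Then: (1) $D$ is a minimal dominating set if and only if every vertex of $D$ has a $D$-private closed neighbor; (2) $D$ is irreducible if and only if every vertex of $D$ either has a $D$-private closed neighbor or is adjacent to a $D$-leaf. Consequently, $D$ is reducible if and only if it has a vertex that has no $D$-private closed neighbor and is not adjacent to any $D$-leaf.
   Context: Graphs are finite, simple, undirected. $N(v)$ is the open neighborhood and $N[v]=N(v)\cup\{v\}$; for $S\subseteq V(G)$, $N(S)=\bigcup_{v\in S}N(v)$ and $N[S]=\bigcup_{v\in S}N[v]$. $D$ is dominating if $N[D]=V(G)$. A dominating set $D$ is reducible if there is $u\in D$ such that $D\setminus\{u\}$ is also dominating and $N(D)=N(D\setminus\{u\})$; otherwise $D$ is irreducible. For $u\in D$ and $v\in V(G)$, $v$ is a $D$-private closed neighbor of $u$ if $N[v]\cap D=\{u\}$. A $D$-leaf is a vertex of $D$ having exactly one neighbor in $D$. -}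

module Defs where

open import Data.Nat using (ℕ)
open import Data.Bool using (Bool; true; false)
open import Data.Fin using (Fin)
open import Data.Fin.Subset using (Subset; _∈_; _∉_; _⊆_; _-_)
open import Data.Product using (Σ; ∃; _×_; _,_)
open import Data.Sum using (_⊎_)
open import Relation.Binary.PropositionalEquality using (_≡_; _≢_)
open import Function.Bundles using (_⇔_)
open import Relation.Nullary using (¬_)

record Graph : Set where
  field
    n      : ℕ
    adj    : Fin n → Fin n → Bool
    sym    : ∀ u v → adj u v ≡ adj v u
    irrefl : ∀ v → adj v v ≡ false

module _ (G : Graph) where
  open Graph G

  V : Set
  V = Fin n

  Adj : V → V → Set
  Adj u v = adj u v ≡ true

  _∈N_ : V → Subset n → Set
  v ∈N S = Σ V λ u → u ∈ S × Adj u v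

  _∈N[_] : V → Subset n → Set
  v ∈N[ S ] = Σ V λ u → u ∈ S × (u ≡ v ⊎ Adj u v)

  InClosedNbhd : V → V → Set
  InClosedNbhd w v = w ≡ v ⊎ Adj v w

  Dominating : Subset n → Set
  Dominating D = ∀ v → v ∈N[ D ]

  MinimalDominating : Subset n → Set
  MinimalDominating D =
    Dominating D × (∀ D′ → D′ ⊆ D → Dominating D′ → D ⊆ D′)

  Reducible : Subset n → Set
  Reducible D = Σ V λ u → u ∈ D × Dominating (D - u)
                  × (∀ v → (v ∈N D) ⇔ (v ∈N (D - u)))

  Irreducible : Subset n → Set
  Irreducible D = ¬ Reducible D

  PrivateClosedNbr : Subset n → V → V → Set
  PrivateClosedNbr D u v =
    (u ∈ D × InClosedNbhd u v) × (∀ w → w ∈ D → InClosedNbhd w v → w ≡ u)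

  HasPrivateClosedNbr : Subset n → V → Set
  HasPrivateClosedNbr D u = Σ V λ v → PrivateClosedNbr D u v

  DLeaf : Subset n → V → Set
  DLeaf D x = x ∈ D × (Σ V λ y → (y ∈ D × Adj x y) × (∀ z → z ∈ D → Adj x z → z ≡ y))

  AdjToDLeaf : Subset n → V → Set
  AdjToDLeaf D u = Σ V λ x → DLeaf D x × Adj u x

-- Removing u from a dominating set D can only undominate the D-private closed
-- neighbours of u, so D - u is dominating exactly when u has none; this gives (1).
-- Removing u shrinks N(D) only at a neighbour v of u whose sole closed neighbour
-- in D is u: if v ∉ D then v is a private closed neighbour of u, and if v ∈ D
-- then v is a D-leaf adjacent to u.  Hence D is reducible at u iff u has neither
-- a private closed neighbour nor a D-leaf neighbour, which gives (2) and (3).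
module Submission where

open import Defs
open import Data.Fin.Subset using (Subset; _∈_)
open import Data.Product using (Σ; _×_)
open import Data.Sum using (_⊎_)
open import Function.Bundles using (_⇔_)
open import Relation.Nullary using (¬_)

open import Data.Bool as Bool using (true)
open import Data.Empty using (⊥)
open import Data.Fin using (Fin) renaming (_≟_ to _≟ᶠ_)
open import Data.Fin.Properties using (any?; all?; ¬∀⟶∃¬)
open import Data.Fin.Subset using (_∉_; _⊆_; _─_; _-_; inside; outside)
open import Data.Fin.Subset.Properties
  using (_∈?_; p─q⊆p; x∈p∧x≢y⇒x∈p-y; x∉⁅y⁆⇒x≢y)
open import Data.Product using (_,_; map₂)
open import Data.Sum using (inj₁; inj₂; [_,_])
open import Data.Vec.Base using (_∷_; here; there)
open import Function.Base using (_∘_)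
open import Function.Bundles using (mk⇔; Equivalence)
open import Relation.Binary.PropositionalEquality
  using (_≡_; _≢_; refl; sym; trans; subst)
open import Relation.Nullary using (Dec; yes; no; contradiction)
open import Relation.Nullary.Decidable
  using (_×-dec_; _⊎-dec_; _→-dec_; decidable-stable)

x∈p─q⇒x∉q : ∀ {m} {x : Fin m} {p q : Subset m} → x ∈ p ─ q → x ∉ q
x∈p─q⇒x∉q {p = inside ∷ _} {outside ∷ _} here ()
x∈p─q⇒x∉q {p = _ ∷ _} {_ ∷ _} (there x∈) (there x∈q) = x∈p─q⇒x∉q x∈ x∈q

module _ {m} {p : Subset m} {y : Fin m} where

  x∈p-y⇒x∈p : ∀ {x} → x ∈ p - y → x ∈ p
  x∈p-y⇒x∈p = p─q⊆p p _

  x∈p-y⇒x≢y : ∀ {x} → x ∈ p - y → x ≢ y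
  x∈p-y⇒x≢y = x∉⁅y⁆⇒x≢y ∘ x∈p─q⇒x∉q

  none∈p-y⇒sole : ∀ {ℓ} {P : Fin m → Set ℓ} →
    ¬ (Σ (Fin m) λ w → w ∈ p - y × P w) → ∀ w → w ∈ p → P w → w ≡ y
  none∈p-y⇒sole none w w∈p Pw =
    decidable-stable (w ≟ᶠ y) λ w≢y → none (w , x∈p∧x≢y⇒x∈p-y w∈p w≢y , Pw)

  sole⇒none∈p-y : ∀ {ℓ} {P : Fin m → Set ℓ} →
    (∀ w → w ∈ p → P w → w ≡ y) → ¬ (Σ (Fin m) λ w → w ∈ p - y × P w)
  sole⇒none∈p-y sole (w , w∈ , Pw) = x∈p-y⇒x≢y w∈ (sole w (x∈p-y⇒x∈p w∈) Pw)

module _ (G : Graph) where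
  open Graph G using (n; adj)

  Adj-sym : ∀ {u v} → Adj G u v → Adj G v u
  Adj-sym {u} {v} = trans (Graph.sym G v u)

  closed-sym : ∀ {u v} → u ≡ v ⊎ Adj G u v → InClosedNbhd G u v
  closed-sym (inj₁ u≡v) = inj₁ u≡v
  closed-sym (inj₂ uv)  = inj₂ (Adj-sym uv)

  closed-sym⁻ : ∀ {u v} → InClosedNbhd G u v → u ≡ v ⊎ Adj G u v
  closed-sym⁻ (inj₁ u≡v) = inj₁ u≡v
  closed-sym⁻ (inj₂ vu)  = inj₂ (Adj-sym vu)

  adj? : ∀ u v → Dec (Adj G u v)
  adj? u v = adj u v Bool.≟ true

  closed? : ∀ w v → Dec (InClosedNbhd G w v)
  closed? w v = (w ≟ᶠ v) ⊎-dec adj? v w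

  ∈N? : ∀ v S → Dec (_∈N_ G v S)
  ∈N? v S = any? λ u → (u ∈? S) ×-dec adj? u v

  ∈N[]? : ∀ v S → Dec (_∈N[_] G v S)
  ∈N[]? v S = any? λ u → (u ∈? S) ×-dec ((u ≟ᶠ v) ⊎-dec adj? u v)

  hasPrivateClosedNbr? : ∀ D u → Dec (HasPrivateClosedNbr G D u)
  hasPrivateClosedNbr? D u = any? λ v → ((u ∈? D) ×-dec closed? u v)
    ×-dec all? (λ w → (w ∈? D) →-dec (closed? w v →-dec (w ≟ᶠ u)))

  adjToDLeaf? : ∀ D u → Dec (AdjToDLeaf G D u)
  adjToDLeaf? D u = any? λ x → ((x ∈? D) ×-dec any? (λ y → ((y ∈? D) ×-dec adj? x y)
    ×-dec all? (λ z → (z ∈? D) →-dec (adj? x z →-dec (z ≟ᶠ y))))) ×-dec adj? u x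

  ∈N-minus⇒∈N : ∀ {D u v} → _∈N_ G v (D - u) → _∈N_ G v D
  ∈N-minus⇒∈N (w , w∈ , wv) = w , x∈p-y⇒x∈p w∈ , wv

  private⇔¬∈N[-] : ∀ {D u v} → Dominating G D →
    PrivateClosedNbr G D u v ⇔ (¬ _∈N[_] G v (D - u))
  private⇔¬∈N[-] {D} {u} {v} dom = mk⇔
    (λ (_ , sole) → sole⇒none∈p-y (λ w w∈D → sole w w∈D ∘ closed-sym))
    λ undominated →
      let sole = none∈p-y⇒sole undominated
          (w , w∈D , wv) = dom v
      in (subst (_∈ D) (sole w w∈D wv) w∈D
         , closed-sym (subst (λ x → x ≡ v ⊎ Adj G x v) (sole w w∈D wv) wv))
         , λ w w∈D → sole w w∈D ∘ closed-sym⁻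

  dominating-⇔¬private : ∀ {D u} → Dominating G D →
    Dominating G (D - u) ⇔ (¬ HasPrivateClosedNbr G D u)
  dominating-⇔¬private {D} {u} dom = mk⇔
    (λ dom-u (v , priv) → Equivalence.to (private⇔¬∈N[-] dom) priv (dom-u v))
    λ ¬priv v → decidable-stable (∈N[]? v (D - u))
      λ undominated → ¬priv (v , Equivalence.from (private⇔¬∈N[-] dom) undominated)

  ¬dominating-⇒private : ∀ {D u} → Dominating G D →
    ¬ Dominating G (D - u) → HasPrivateClosedNbr G D u
  ¬dominating-⇒private {D} {u} dom ¬dom-u =
    map₂ (Equivalence.from (private⇔¬∈N[-] dom))
         (¬∀⟶∃¬ n _ (λ v → ∈N[]? v (D - u)) ¬dom-u)

  ∈N-preserved⇒¬adjToDLeaf : ∀ {D u} → u ∈ D →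
    (∀ v → _∈N_ G v D → _∈N_ G v (D - u)) → ¬ AdjToDLeaf G D u
  ∈N-preserved⇒¬adjToDLeaf u∈D preserved (x , (_ , y , _ , sole) , ux) =
    sole⇒none∈p-y (λ w w∈D wx → trans (sole w w∈D (Adj-sym wx))
                                      (sym (sole _ u∈D (Adj-sym ux))))
                  (preserved x (_ , u∈D , ux))

  ¬private×¬adjToDLeaf⇒∈N-preserved : ∀ {D u} →
    ¬ HasPrivateClosedNbr G D u → ¬ AdjToDLeaf G D u →
    ∀ v → _∈N_ G v D → _∈N_ G v (D - u)
  ¬private×¬adjToDLeaf⇒∈N-preserved {D} {u} ¬priv ¬leaf v (w , w∈D , wv)
    with w ≟ᶠ u
  ... | no w≢u = w , x∈p∧x≢y⇒x∈p-y w∈D w≢u , wv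
  ... | yes refl = decidable-stable (∈N? v (D - u)) λ none →
    let sole = none∈p-y⇒sole none in
    case-v∈D sole (v ∈? D)
    where
    case-v∈D : (∀ z → z ∈ D → Adj G z v → z ≡ u) → Dec (v ∈ D) → ⊥
    case-v∈D sole (yes v∈D) =
      ¬leaf (v , (v∈D , u , (w∈D , Adj-sym wv) , λ z z∈D → sole z z∈D ∘ Adj-sym) , wv)
    case-v∈D sole (no v∉D) = ¬priv (v , (w∈D , inj₂ (Adj-sym wv)) , only-u)
      where
      only-u : ∀ z → z ∈ D → InClosedNbhd G z v → z ≡ u
      only-u z z∈D (inj₁ refl) = contradiction z∈D v∉D
      only-u z z∈D (inj₂ vz)   = sole z z∈D (Adj-sym vz)

  reducible-at⇔ : ∀ {D u} → Dominating G D → u ∈ D →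
    (Dominating G (D - u) × (∀ v → (_∈N_ G v D) ⇔ (_∈N_ G v (D - u))))
    ⇔ (¬ HasPrivateClosedNbr G D u × ¬ AdjToDLeaf G D u)
  reducible-at⇔ dom u∈D = mk⇔
    (λ (dom-u , same) → Equivalence.to (dominating-⇔¬private dom) dom-u
                      , ∈N-preserved⇒¬adjToDLeaf u∈D (Equivalence.to ∘ same))
    λ (¬priv , ¬leaf) → Equivalence.from (dominating-⇔¬private dom) ¬priv
                      , λ v → mk⇔ (¬private×¬adjToDLeaf⇒∈N-preserved ¬priv ¬leaf v)
                                  ∈N-minus⇒∈N

  minimal⇔all-private : ∀ {D} → Dominating G D →
    MinimalDominating G D ⇔ (∀ u → u ∈ D → HasPrivateClosedNbr G D u)
  minimal⇔all-private {D} dom = mk⇔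
    (λ (_ , minimal) u u∈D → ¬dominating-⇒private dom λ dom-u →
      x∈p-y⇒x≢y (minimal (D - u) x∈p-y⇒x∈p dom-u u∈D) refl)
    λ all-private → dom , λ D′ D′⊆D dom′ {x} x∈D →
      private∈dominating (λ {y} → D′⊆D {y}) dom′ (all-private x x∈D)
    where
    private∈dominating : ∀ {D′ x} → D′ ⊆ D → Dominating G D′ →
      HasPrivateClosedNbr G D x → x ∈ D′
    private∈dominating {D′} D′⊆D dom′ (v , _ , sole) =
      let (w , w∈D′ , wv) = dom′ v
      in subst (_∈ D′) (sole w (D′⊆D w∈D′) (closed-sym wv)) w∈D′

  reducible⇔ : ∀ {D} → Dominating G D →
    Reducible G D ⇔ Σ (V G) (λ u → u ∈ D × ¬ HasPrivateClosedNbr G D u × ¬ AdjToDLeaf G D u)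
  reducible⇔ dom = mk⇔
    (λ (u , u∈D , rest) → u , u∈D , Equivalence.to (reducible-at⇔ dom u∈D) rest)
    (λ (u , u∈D , rest) → u , u∈D , Equivalence.from (reducible-at⇔ dom u∈D) rest)

  irreducible⇔ : ∀ {D} → Dominating G D →
    Irreducible G D ⇔ (∀ u → u ∈ D → HasPrivateClosedNbr G D u ⊎ AdjToDLeaf G D u)
  irreducible⇔ {D} dom = mk⇔ private-or-leaf
    λ all u-red → let (u , u∈D , ¬priv , ¬leaf) = Equivalence.to (reducible⇔ dom) u-red
                  in [ ¬priv , ¬leaf ] (all u u∈D)
    where
    private-or-leaf : Irreducible G D → ∀ u → u ∈ D →
      HasPrivateClosedNbr G D u ⊎ AdjToDLeaf G D u
    private-or-leaf irr u u∈D with hasPrivateClosedNbr? D u | adjToDLeaf? D u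
    ... | yes priv | _        = inj₁ priv
    ... | no _     | yes leaf = inj₂ leaf
    ... | no ¬priv | no ¬leaf =
      contradiction (Equivalence.from (reducible⇔ dom) (u , u∈D , ¬priv , ¬leaf)) irr

proposition4 : (G : Graph) → (D : Subset (Graph.n G)) → Dominating G D →
    (MinimalDominating G D ⇔ (∀ u → u ∈ D → HasPrivateClosedNbr G D u))
    × (Irreducible G D ⇔ (∀ u → u ∈ D → HasPrivateClosedNbr G D u ⊎ AdjToDLeaf G D u))
    × (Reducible G D ⇔ Σ (V G) (λ u → u ∈ D × ¬ HasPrivateClosedNbr G D u × ¬ AdjToDLeaf G D u))
proposition4 G D dom = minimal⇔all-private G dom , irreducible⇔ G dom , reducible⇔ G dom
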